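{- Let $L$ be a finite atomic lattice with $n$ atoms, let $\gamma:\mathcal{A}(L)\to[n]$ be a bijection, and let $\lambda_\gamma$ be the associated minimal labeling. Then for every saturated chain $x_1\lessdot x_2\lessdot\cdots\lessdot x_k$ in $L$, we have $\lambda_\gamma(x_i,x_{i+1})\neq\lambda_\gamma(x_j,x_{j+1})$ whenever $i\neq j$; that is, the labels along any saturated chain are distinct.
   Context: $\mathcal{A}(L)$ denotes the set of atoms of $L$ (elements covering the minimum $\hat 0$); $L$ is atomic if every element is a join of atoms. For $x\in L$ let $A(x)=\{a\in\mathcal{A}(L): a\le x\}$. For a bijection $\gamma:\mathcal{A}(L)\to[n]$, the minimal labeling assigns to each cover relation $x\lessdot y$ the label $\lambda_\gamma(x,y)=\min\bigl(\gamma(A(y))\setminus\gamma(A(x))\bigr)$, where $\gamma(S)=\{\gamma(a):a\in S\}$. -}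

module Defs where

open import Level using (Level; _⊔_)
open import Data.Nat using (ℕ; suc)
open import Data.Fin using (Fin; inject₁) renaming (suc to fsuc; _≤_ to _≤ᶠ_)
open import Data.List using (List; foldr)
open import Data.List.Relation.Unary.All using (All)
open import Data.List.Relation.Unary.Any using (Any)
open import Data.Product using (Σ; ∃; _×_; proj₁)
open import Relation.Nullary using (¬_)
open import Relation.Binary.PropositionalEquality using (_≡_)
open import Relation.Binary.Lattice.Bundles using (BoundedLattice)

module _ {c ℓ₁ ℓ₂ : Level} (L : BoundedLattice c ℓ₁ ℓ₂) where
  open BoundedLattice L

  _<L_ : Carrier → Carrier → Set (ℓ₁ ⊔ ℓ₂)
  x <L y = x ≤ y × ¬ (x ≈ y)

  Covers : Carrier → Carrier → Set (c ⊔ ℓ₁ ⊔ ℓ₂)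
  Covers x y = x <L y × (∀ z → ¬ (x <L z × z <L y))

  IsAtom : Carrier → Set (c ⊔ ℓ₁ ⊔ ℓ₂)
  IsAtom a = Covers ⊥ a

  Atom : Set (c ⊔ ℓ₁ ⊔ ℓ₂)
  Atom = Σ Carrier IsAtom

  IsFinite : Set (c ⊔ ℓ₁)
  IsFinite = ∃ λ (xs : List Carrier) → ∀ x → Any (x ≈_) xs

  IsAtomic : Set (c ⊔ ℓ₁ ⊔ ℓ₂)
  IsAtomic = ∀ x → ∃ λ (as : List Carrier) → All IsAtom as × (x ≈ foldr _∨_ ⊥ as)

  record IsAtomBijection (n : ℕ) (γ : Atom → Fin n) : Set (c ⊔ ℓ₁ ⊔ ℓ₂) where
    field
      respects   : ∀ (a b : Atom) → proj₁ a ≈ proj₁ b → γ a ≡ γ b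
      injective  : ∀ (a b : Atom) → γ a ≡ γ b → proj₁ a ≈ proj₁ b
      surjective : ∀ (i : Fin n) → ∃ λ (a : Atom) → γ a ≡ i

  InLabelSet : ∀ {n} → (Atom → Fin n) → Carrier → Carrier → Fin n → Set (c ⊔ ℓ₁ ⊔ ℓ₂)
  InLabelSet γ x y i =
    (∃ λ (a : Atom) → proj₁ a ≤ y × γ a ≡ i) ×
    ¬ (∃ λ (a : Atom) → proj₁ a ≤ x × γ a ≡ i)

  -- "λ_γ(x,y) = i":  i is the minimum of γ(A(y)) ∖ γ(A(x))
  MinLabel : ∀ {n} → (Atom → Fin n) → Carrier → Carrier → Fin n → Set (c ⊔ ℓ₁ ⊔ ℓ₂)
  MinLabel γ x y i =
    InLabelSet γ x y i × (∀ j → InLabelSet γ x y j → i ≤ᶠ j)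

  -- saturated chain x₀ ⋖ x₁ ⋖ ⋯ ⋖ x_k  (k+1 elements, k cover relations)
  IsSaturatedChain : ∀ {k} → (Fin (suc k) → Carrier) → Set (c ⊔ ℓ₁ ⊔ ℓ₂)
  IsSaturatedChain {k} x = ∀ (i : Fin k) → Covers (x (inject₁ i)) (x (fsuc i))

-- Along a chain, i < j gives x_{i+1} ≤ x_j, so the atom realising λ(x_i, x_{i+1})
-- already lies below x_j and its label cannot belong to γ(A(x_{j+1})) ∖ γ(A(x_j)).
module Submission where

open import Defs
open import Level using (Level)
open import Data.Nat using (ℕ; suc; z≤n; s≤s)
import Data.Nat.Properties as ℕ
open import Data.Fin using (Fin; inject₁)
  renaming (suc to fsuc; zero to fzero; _≤_ to _≤ᶠ_; _<_ to _<ᶠ_)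
open import Data.Fin.Properties using (toℕ-inject₁; <-cmp)
open import Data.Product using (_,_; proj₁)
open import Relation.Binary using (tri<; tri≈; tri>)
open import Relation.Binary.Bundles using (Preorder)
open import Relation.Nullary using (¬_)
open import Relation.Binary.PropositionalEquality using (_≡_; refl; sym)
open import Relation.Binary.Lattice.Bundles using (BoundedLattice)

module _ {c ℓ₁ ℓ₂ : Level} (P : Preorder c ℓ₁ ℓ₂) where
  open Preorder P renaming (refl to ≲-refl; trans to ≲-trans)

  stepwise-increasing⇒monotone : ∀ {k} (x : Fin (suc k) → Carrier) →
    (∀ i → x (inject₁ i) ≲ x (fsuc i)) →
    ∀ {i j} → i ≤ᶠ j → x i ≲ x j
  stepwise-increasing⇒monotone x step {fzero} {fzero} _ = ≲-refl
  stepwise-increasing⇒monotone {suc k} x step {fzero} {fsuc j} _ =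
    ≲-trans (step fzero)
      (stepwise-increasing⇒monotone (λ t → x (fsuc t)) (λ t → step (fsuc t)) {fzero} {j} z≤n)
  stepwise-increasing⇒monotone {suc k} x step {fsuc i} {fsuc j} (s≤s i≤j) =
    stepwise-increasing⇒monotone (λ t → x (fsuc t)) (λ t → step (fsuc t)) i≤j

<⇒suc≤inject₁ : ∀ {k} {i j : Fin k} → i <ᶠ j → fsuc i ≤ᶠ inject₁ j
<⇒suc≤inject₁ {j = j} i<j = ℕ.≤-trans i<j (ℕ.≤-reflexive (sym (toℕ-inject₁ j)))

module _ {c ℓ₁ ℓ₂ : Level} (L : BoundedLattice c ℓ₁ ℓ₂) where
  open BoundedLattice L using (Carrier; _≤_; preorder) renaming (trans to ≤-trans)

  label-absent-above : ∀ {n} (γ : Atom L → Fin n) {x y z w : Carrier} {a : Fin n} →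
    InLabelSet L γ x y a → y ≤ z → ¬ InLabelSet L γ z w a
  label-absent-above γ ((α , α≤y , γα≡a) , _) y≤z (_ , a∉z) = a∉z (α , ≤-trans α≤y y≤z , γα≡a)

  saturatedChain-monotone : ∀ {k} (x : Fin (suc k) → Carrier) → IsSaturatedChain L x →
    ∀ {i j} → i ≤ᶠ j → x i ≤ x j
  saturatedChain-monotone x sat =
    stepwise-increasing⇒monotone preorder x (λ i → proj₁ (proj₁ (sat i)))

  minLabel-earlier≢later : ∀ {n} (γ : Atom L → Fin n) {k} (x : Fin (suc k) → Carrier) →
    IsSaturatedChain L x → ∀ {i j : Fin k} → i <ᶠ j → ∀ {a b : Fin n} →
    MinLabel L γ (x (inject₁ i)) (x (fsuc i)) a →
    MinLabel L γ (x (inject₁ j)) (x (fsuc j)) b →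
    ¬ (a ≡ b)
  minLabel-earlier≢later γ x sat i<j (a∈ , _) (b∈ , _) refl =
    label-absent-above γ a∈ (saturatedChain-monotone x sat (<⇒suc≤inject₁ i<j)) b∈

lemma1 : ∀ {c ℓ₁ ℓ₂ : Level} (L : BoundedLattice c ℓ₁ ℓ₂) →
    IsFinite L → IsAtomic L →
    (n : ℕ) (γ : Atom L → Fin n) → IsAtomBijection L n γ →
    (k : ℕ) (x : Fin (suc k) → BoundedLattice.Carrier L) → IsSaturatedChain L x →
    ∀ (i j : Fin k) → ¬ (i ≡ j) →
    ∀ (a b : Fin n) →
    MinLabel L γ (x (inject₁ i)) (x (fsuc i)) a →
    MinLabel L γ (x (inject₁ j)) (x (fsuc j)) b →
    ¬ (a ≡ b)
lemma1 L _ _ n γ _ k x sat i j i≢j a b λᵢ≡a λⱼ≡b with <-cmp i j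
... | tri< i<j _ _ = minLabel-earlier≢later L γ x sat i<j λᵢ≡a λⱼ≡b
... | tri≈ _ i≡j _ = λ _ → i≢j i≡j
... | tri> _ _ j<i = λ a≡b → minLabel-earlier≢later L γ x sat j<i λⱼ≡b λᵢ≡a (sym a≡b)
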